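{- For all sets $\Gamma\cup\{\phi\}\subseteq\mathcal{L}_\Delta$: $\Gamma$ entails $\phi$ over the class of all $c$-models under the new semantics $\Vvdash$ if and only if $\Gamma$ entails $\phi$ over the class of all neighborhood models under the old semantics $\Vdash$. In particular, for every $\phi\in\mathcal{L}_\Delta$, $\phi$ is valid on all $c$-models under $\Vvdash$ iff $\phi$ is valid on all neighborhood models under $\Vdash$.
   Context: Fix a countable set $\mathbf{Prop}$ of propositional variables. The language $\mathcal{L}_\Delta$ is given by $\phi::=p\mid\neg\phi\mid(\phi\land\phi)\mid\Delta\phi$ with $p\in\mathbf{Prop}$. A neighborhood model is $\mathcal{M}=\langle S,N,V\rangle$ with $S$ nonempty, $N:S\to 2^{2^S}$ and $V:\mathbf{Prop}\to 2^S$. Old semantics $\Vdash$: $\mathcal{M},s\Vdash p$ iff $s\in V(p)$, Boolean clauses as usual, and $\mathcal{M},s\Vdash\Delta\phi$ iff $\{t:\mathcal{M},t\Vdash\phi\}\in N(s)$ or $\{t:\mathcal{M},t\Vdash\neg\phi\}\in N(s)$. New semantics $\Vvdash$: identical except $\mathcal{M},s\Vvdash\Delta\phi$ iff $\phi^{\mathcal{M}}\in N(s)$, where $\phi^{\mathcal{M}}=\{t\in S:\mathcal{M},t\Vvdash\phi\}$. A $c$-model is a neighborhood model such that for all $s\in S$ and $X\subseteq S$, $X\in N(s)$ implies $S\setminus X\in N(s)$. "$\Gamma$ entails $\phi$ over a class $\mathsf{C}$ under a semantics" means: for every model $\mathcal{M}\in\mathsf{C}$ and state $s$, if $s$ satisfies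 every $\psi\in\Gamma$ then $s$ satisfies $\phi$. -}

module Defs where

open import Data.Nat using (ℕ)
open import Data.Empty using (⊥)
open import Data.Bool using (Bool; true; false; not; _∧_; _∨_)
open import Relation.Binary.PropositionalEquality using (_≡_)

Prop : Set
Prop = ℕ

data Form : Set where
  var : Prop → Form
  ¬'_ : Form → Form
  _∧'_ : Form → Form → Form
  Δ_ : Form → Form

Subset : Set → Set
Subset S = S → Bool

_≐_ : {S : Set} → Subset S → Subset S → Set
X ≐ Y = ∀ t → X t ≡ Y t

-- N(s) is a family of
-- subsets of S, given by its characteristic function on subsets; since
-- subsets are represented by functions, N(s) is required to respect
-- extensional equality of subsets (so that it really is a set of subsets).
record Model : Set₁ where
  field
    S      : Set
    point  : S
    N      : S → Subset S → Bool
    N-ext  : ∀ s {X Y} → X ≐ Y → N s X ≡ N s Y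
    V      : Prop → Subset S
open Model public

∁ : {S : Set} → Subset S → Subset S
∁ X t = not (X t)

IsCModel : Model → Set
IsCModel M = ∀ s (X : Subset (S M)) → N M s X ≡ true → N M s (∁ X) ≡ true

⟦_⟧old : Form → (M : Model) → Subset (S M)
⟦ var p ⟧old M s = V M p s
⟦ ¬' φ ⟧old M s = not (⟦ φ ⟧old M s)
⟦ φ ∧' ψ ⟧old M s = ⟦ φ ⟧old M s ∧ ⟦ ψ ⟧old M s
⟦ Δ φ ⟧old M s = N M s (⟦ φ ⟧old M) ∨ N M s (∁ (⟦ φ ⟧old M))

⟦_⟧new : Form → (M : Model) → Subset (S M)
⟦ var p ⟧new M s = V M p s
⟦ ¬' φ ⟧new M s = not (⟦ φ ⟧new M s)
⟦ φ ∧' ψ ⟧new M s = ⟦ φ ⟧new M s ∧ ⟦ ψ ⟧new M s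
⟦ Δ φ ⟧new M s = N M s (⟦ φ ⟧new M)

_,_⊩_ : (M : Model) → S M → Form → Set
M , s ⊩ φ = ⟦ φ ⟧old M s ≡ true

_,_⫼_ : (M : Model) → S M → Form → Set
M , s ⫼ φ = ⟦ φ ⟧new M s ≡ true

FormSet : Set₁
FormSet = Form → Set

_⊨old_ : FormSet → Form → Set₁
Γ ⊨old φ = ∀ (M : Model) (s : S M) →
  (∀ ψ → Γ ψ → M , s ⊩ ψ) → M , s ⊩ φ

_⊨c-new_ : FormSet → Form → Set₁
Γ ⊨c-new φ = ∀ (M : Model) → IsCModel M → (s : S M) →
  (∀ ψ → Γ ψ → M , s ⫼ ψ) → M , s ⫼ φ

∅ : FormSet
∅ _ = ⊥

-- Under ⊩, Δφ holds at s iff φ's truth set or its complement lies in N(s),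
-- i.e. iff φ's truth set lies in the complement-closure of N(s).  So ⊩ on a
-- model is ⫼ on its complement-closure, which is a c-model; and on a c-model
-- the closure changes nothing, so there ⊩ and ⫼ already agree.
module Submission where

open import Defs
open import Data.Product using (_×_; _,_)
open import Data.Bool using (Bool; true; false; not; _∧_; _∨_)
open import Data.Bool.Properties using (not-involutive; ∨-comm; ∨-idem)
open import Relation.Binary.PropositionalEquality
  using (_≡_; refl; sym; trans; cong; cong₂; module ≡-Reasoning)

≡true-antisym : ∀ {a b : Bool} → (a ≡ true → b ≡ true) → (b ≡ true → a ≡ true) → a ≡ b
≡true-antisym {false} {false} _ _ = refl
≡true-antisym {false} {true}  _ b⇒a = b⇒a refl
≡true-antisym {true}  {false} a⇒b _ = sym (a⇒b refl)
≡true-antisym {true}  {true}  _ _ = refl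

∁-involutive : ∀ {S : Set} (X : Subset S) → ∁ (∁ X) ≐ X
∁-involutive X t = not-involutive (X t)

∁-cong : ∀ {S : Set} {X Y : Subset S} → X ≐ Y → ∁ X ≐ ∁ Y
∁-cong X≐Y t = cong not (X≐Y t)

module _ (M : Model) where

  N-∁∁ : ∀ s (X : Subset (S M)) → N M s (∁ (∁ X)) ≡ N M s X
  N-∁∁ s X = N-ext M s (∁-involutive X)

  N-∨-∁-cong : ∀ s {X Y : Subset (S M)} → X ≐ Y →
               N M s X ∨ N M s (∁ X) ≡ N M s Y ∨ N M s (∁ Y)
  N-∨-∁-cong s X≐Y = cong₂ _∨_ (N-ext M s X≐Y) (N-ext M s (∁-cong X≐Y))

  complementClosure : Model
  complementClosure = record
    { S     = S M
    ; point = point M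
    ; N     = λ s X → N M s X ∨ N M s (∁ X)
    ; N-ext = N-∨-∁-cong
    ; V     = V M
    }

  complementClosure-isCModel : IsCModel complementClosure
  complementClosure-isCModel s X X∈N = begin
    N M s (∁ X) ∨ N M s (∁ (∁ X))  ≡⟨ cong (N M s (∁ X) ∨_) (N-∁∁ s X) ⟩
    N M s (∁ X) ∨ N M s X          ≡⟨ ∨-comm (N M s (∁ X)) (N M s X) ⟩
    N M s X ∨ N M s (∁ X)          ≡⟨ X∈N ⟩
    true                           ∎
    where open ≡-Reasoning

  ⟦⟧new-complementClosure : ∀ φ → ⟦ φ ⟧new complementClosure ≐ ⟦ φ ⟧old M
  ⟦⟧new-complementClosure (var p)  s = refl
  ⟦⟧new-complementClosure (¬' φ)   s = cong not (⟦⟧new-complementClosure φ s)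
  ⟦⟧new-complementClosure (φ ∧' ψ) s =
    cong₂ _∧_ (⟦⟧new-complementClosure φ s) (⟦⟧new-complementClosure ψ s)
  ⟦⟧new-complementClosure (Δ φ)    s = N-∨-∁-cong s (⟦⟧new-complementClosure φ)

  module _ (c : IsCModel M) where

    N-∁-cModel : ∀ s (X : Subset (S M)) → N M s (∁ X) ≡ N M s X
    N-∁-cModel s X = ≡true-antisym
      (λ ∁X∈N → trans (sym (N-∁∁ s X)) (c s (∁ X) ∁X∈N))
      (c s X)

    N-∨-∁-cModel : ∀ s (X : Subset (S M)) → N M s X ∨ N M s (∁ X) ≡ N M s X
    N-∨-∁-cModel s X = trans (cong (N M s X ∨_) (N-∁-cModel s X)) (∨-idem (N M s X))

    ⟦⟧old≐new-cModel : ∀ φ → ⟦ φ ⟧old M ≐ ⟦ φ ⟧new M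
    ⟦⟧old≐new-cModel (var p)  s = refl
    ⟦⟧old≐new-cModel (¬' φ)   s = cong not (⟦⟧old≐new-cModel φ s)
    ⟦⟧old≐new-cModel (φ ∧' ψ) s =
      cong₂ _∧_ (⟦⟧old≐new-cModel φ s) (⟦⟧old≐new-cModel ψ s)
    ⟦⟧old≐new-cModel (Δ φ)    s =
      trans (N-∨-∁-cong s (⟦⟧old≐new-cModel φ)) (N-∨-∁-cModel s (⟦ φ ⟧new M))

⊨c-new⇒⊨old : ∀ Γ φ → Γ ⊨c-new φ → Γ ⊨old φ
⊨c-new⇒⊨old Γ φ Γ⊨φ M s s⊩Γ =
  trans (sym (agree φ s)) (Γ⊨φ (complementClosure M) (complementClosure-isCModel M) s
                                (λ ψ ψ∈Γ → trans (agree ψ s) (s⊩Γ ψ ψ∈Γ)))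
  where agree = ⟦⟧new-complementClosure M

⊨old⇒⊨c-new : ∀ Γ φ → Γ ⊨old φ → Γ ⊨c-new φ
⊨old⇒⊨c-new Γ φ Γ⊨φ M c s s⫼Γ =
  trans (sym (agree φ s)) (Γ⊨φ M s (λ ψ ψ∈Γ → trans (agree ψ s) (s⫼Γ ψ ψ∈Γ)))
  where agree = ⟦⟧old≐new-cModel M c

corollary1 : (∀ (Γ : FormSet) (φ : Form) →
    ((Γ ⊨c-new φ → Γ ⊨old φ) × (Γ ⊨old φ → Γ ⊨c-new φ)))
    × (∀ (φ : Form) →
    ((∅ ⊨c-new φ → ∅ ⊨old φ) × (∅ ⊨old φ → ∅ ⊨c-new φ)))
corollary1 = (λ Γ φ → ⊨c-new⇒⊨old Γ φ , ⊨old⇒⊨c-new Γ φ)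
           , (λ φ → ⊨c-new⇒⊨old ∅ φ , ⊨old⇒⊨c-new ∅ φ)
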